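{- Let $F:\mathsf{Set}^k\to\mathsf{Set}$ and $\bar K=(K_1,\dots,K_h):\mathsf{Set}^k\to\mathsf{Set}^h$ be functors, and let $(\mathrm{Lan}_{\bar K}F,\eta)$ be the left Kan extension of $F$ along $\bar K$. If $L:\mathsf{Set}^h\to\mathsf{Set}$ is a functor such that (i) $L\bar A\subseteq(\mathrm{Lan}_{\bar K}F)\bar A$ for all $\bar A\in\mathsf{Set}^h$, (ii) $(\mathrm{Lan}_{\bar K}F)\bar f\,(x)\in L\bar B$ for all morphisms $\bar f:\bar A\to\bar B$ in $\mathsf{Set}^h$ and all $x\in L\bar A$ (and the action of $L$ on $\bar f$ is this restriction), and (iii) $\eta_{\bar A}\,y\in L(\bar K\bar A)$ for all $\bar A\in\mathsf{Set}^k$ and $y\in F\bar A$, then $L=\mathrm{Lan}_{\bar K}F$.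
   Context: The left Kan extension of $F$ along $\bar K$ is a functor $\mathrm{Lan}_{\bar K}F:\mathsf{Set}^h\to\mathsf{Set}$ with a natural transformation $\eta:F\to(\mathrm{Lan}_{\bar K}F)\circ\bar K$ such that for every functor $G:\mathsf{Set}^h\to\mathsf{Set}$ and natural transformation $\gamma:F\to G\circ\bar K$ there is a unique $\mu:\mathrm{Lan}_{\bar K}F\to G$ with $(\mu\bar K)\circ\eta=\gamma$. In this setting it is taken to be given concretely by the colimit formula $(\mathrm{Lan}_{\bar K}F)\bar A=\mathrm{colim}_{\bar S\in\mathsf{Set}_0^k,\ \bar f:\bar K\bar S\to\bar A}F\bar S$, where $\mathsf{Set}_0$ is the full subcategory of finite sets; writing $\iota_{\bar S,\bar f}:F\bar S\to(\mathrm{Lan}_{\bar K}F)\bar A$ for the colimit injections, the functorial action on $\bar g:\bar A\to\bar B$ is the unique map with $(\mathrm{Lan}_{\bar K}F)\bar g\circ\iota_{\bar S,\bar f}=\iota'_{\bar S,\bar g\circ\bar f}$ (with $\iota'$ the injections into $(\mathrm{Lan}_{\bar K}F)\bar B$). -}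

module Defs where

open import Level using (0ℓ)
open import Data.Nat using (ℕ)
open import Data.Fin using (Fin)
open import Relation.Binary.Core using (Rel)
open import Relation.Binary.PropositionalEquality using (_≡_)
open import Relation.Binary.Construct.Closure.Equivalence using (EqClosure)

Obj : ℕ → Set₁
Obj k = Fin k → Set

Hom : ∀ {k} → Obj k → Obj k → Set
Hom {k} A B = (i : Fin k) → A i → B i

_∘ₕ_ : ∀ {k} {A B C : Obj k} → Hom B C → Hom A B → Hom A C
(g ∘ₕ f) i x = g i (f i x)

idₕ : ∀ {k} {A : Obj k} → Hom A A
idₕ i x = x

record Functor (k : ℕ) : Set₁ where
  field
    obj    : Obj k → Set
    map    : ∀ {A B : Obj k} → Hom A B → obj A → obj B
    map-cong : ∀ {A B : Obj k} {f g : Hom A B} →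
               (∀ i x → f i x ≡ g i x) → ∀ y → map f y ≡ map g y
    map-id : ∀ {A : Obj k} (y : obj A) → map (idₕ {A = A}) y ≡ y
    map-∘  : ∀ {A B C : Obj k} (g : Hom B C) (f : Hom A B) (y : obj A) →
             map (g ∘ₕ f) y ≡ map g (map f y)

-- Objects of Set_0^k, taken up to iso: tuples of standard finite sets Fin n.
FinObj : ∀ {k} → (Fin k → ℕ) → Obj k
FinObj S i = Fin (S i)

-- The colimit formula for Lan_K̄ F, with K̄ = (K_1,…,K_h).
module Lan {k h : ℕ} (F : Functor k) (K : Fin h → Functor k) where

  Kobj : Obj k → Obj h
  Kobj A j = Functor.obj (K j) A

  Kmap : ∀ {A B : Obj k} → Hom A B → Hom (Kobj A) (Kobj B)
  Kmap u j = Functor.map (K j) u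

  -- Elements of ∐_{S̄ ∈ Set_0^k, f̄ : K̄S̄ → Ā} F S̄ ; ι S f y is ι_{S,f}(y).
  record Elem (A : Obj h) : Set where
    constructor ι
    field
      shape : Fin k → ℕ
      arrow : Hom (Kobj (FinObj shape)) A
      val   : Functor.obj F (FinObj shape)

  -- Generating relations of the colimit: for a morphism u : (S,f) → (S',f')
  -- of the comma category (i.e. f' ∘ K̄u = f), ι_{S,f} y ~ ι_{S',f'} (F u y).
  data Step (A : Obj h) : Rel (Elem A) 0ℓ where
    step : ∀ {S S' : Fin k → ℕ} (u : Hom (FinObj S) (FinObj S'))
             (f : Hom (Kobj (FinObj S)) A) (f' : Hom (Kobj (FinObj S')) A) →
             (∀ j x → f' j (Kmap u j x) ≡ f j x) →
             (y : Functor.obj F (FinObj S)) →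
             Step A (ι S f y) (ι S' f' (Functor.map F u y))

  _≈_ : ∀ {A : Obj h} → Rel (Elem A) 0ℓ
  _≈_ {A} = EqClosure (Step A)

  infix 4 _≈_

  lmap : ∀ {A B : Obj h} → Hom A B → Elem A → Elem B
  lmap g (ι S f y) = ι S (g ∘ₕ f) y

{-# OPTIONS --safe #-}
module Submission where

-- Every element ι_{S,f} y of the colimit is (Lan_K̄ F) f̄ applied to ι_{S,id} y, and
-- the latter equals η_S y. So a subfunctor containing the image of η and closed
-- under the action of Lan_K̄ F already contains everything.

open import Defs
open import Data.Nat using (ℕ)
open import Data.Fin using (Fin)
open import Relation.Binary.PropositionalEquality using (_≡_; refl; subst)

module _ {k h : ℕ} (F : Functor k) (K : Fin h → Functor k) where
  open Lan F K

  lmap-generic : ∀ {A : Obj h} (x : Elem A) →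
                 lmap (Elem.arrow x) (ι (Elem.shape x) idₕ (Elem.val x)) ≡ x
  lmap-generic (ι S f y) = refl

  lmap-closed⇒total :
    (L : (A : Obj h) → Elem A → Set) →
    (∀ {A B : Obj h} (g : Hom A B) (x : Elem A) → L A x → L B (lmap g x)) →
    (∀ (S : Fin k → ℕ) (y : Functor.obj F (FinObj S)) → L (Kobj (FinObj S)) (ι S idₕ y)) →
    ∀ (A : Obj h) (x : Elem A) → L A x
  lmap-closed⇒total L closed generic A x@(ι S f y) =
    subst (L A) (lmap-generic x) (closed f (ι S idₕ y) (generic S y))

proposition8p2 : ∀ {k h : ℕ} (F : Functor k) (K : Fin h → Functor k) →
    let open Lan F K in
    -- the unit η : F → (Lan_K̄ F) ∘ K̄ of the Kan extension given by the colimit formula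
    (η : (A : Obj k) → Functor.obj F A → Elem (Kobj A)) →
    (η-natural : ∀ {A B : Obj k} (u : Hom A B) (y : Functor.obj F A) →
                 η B (Functor.map F u y) ≈ lmap (Kmap u) (η A y)) →
    (η-finite : ∀ (S : Fin k → ℕ) (y : Functor.obj F (FinObj S)) →
                η (FinObj S) y ≈ ι S idₕ y) →
    -- L as a subset L Ā ⊆ (Lan_K̄ F) Ā of the colimit (respecting its equality)
    (L : (A : Obj h) → Elem A → Set) →
    (L-resp : ∀ {A : Obj h} {x x' : Elem A} → x ≈ x' → L A x → L A x') →
    -- (ii) closure under the action of Lan_K̄ F (L's action is the restriction)
    (ii : ∀ {A B : Obj h} (g : Hom A B) (x : Elem A) → L A x → L B (lmap g x)) →
    -- (iii) the image of η lies in L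
    (iii : ∀ (A : Obj k) (y : Functor.obj F A) → L (Kobj A) (η A y)) →
    -- conclusion: L = Lan_K̄ F
    ∀ (A : Obj h) (x : Elem A) → L A x
proposition8p2 F K η _ η-finite L L-resp ii iii =
  lmap-closed⇒total F K L ii
    (λ S y → L-resp (η-finite S y) (iii (FinObj S) y))
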